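{- Let $\Gamma\stackrel{\mathcal{T}}{\Rightarrow}\Delta$ be a saturated, possibly infinite tree sequent that is unprovable in $\mathsf{T}\mathbf{EFL}^{ - }$. Define $\mathfrak{M}=(\mathcal{T},A,(R_a)_{a\in A},(\asymp_\alpha)_{\alpha\in\mathcal{T}},V)$ by: $n\sim m$ iff $\alpha:@_nm\in\Gamma$ for some $\alpha\in\mathcal{T}$; $A:=\{|n|: n\in\mathsf{Nom}\}$ where $|n|$ is the $\sim$-class of $n$; $\alpha R_{|n|}\beta$ iff $\beta$ is an $m$-child of $\alpha$ for some $m\in|n|$; $|n|\asymp_\alpha|m|$ iff $\alpha:@_n\langle\mathsf{F}\rangle m\in\Gamma$; $(\alpha,|n|)\in V(m)$ iff $\alpha:@_nm\in\Gamma$ for $m\in\mathsf{Nom}$; $(\alpha,|n|)\in V(p)$ iff $\alpha:@_np\in\Gamma$ for $p\in\mathsf{Prop}$. Then ($\sim$ is an equivalence relation, the definitions are independent of representatives, and) $\mathfrak{M}$ is a model; moreover, for every labelled formula $\alpha:@_n\varphi$: (i) if $\alpha:@_n\varphi\in\Gamma$ then $\mathfrak{M},(\alpha,|n|)\models\varphi$; (ii) if $\alpha:@_n\varphi\in\Delta$ then $\mathfrak{M},(\alpha,|n|)\not\models\varphi$.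
   Context: Syntax. Disjoint countably infinite sets $\mathsf{Prop}$ and $\mathsf{Nom}$ (agent nominals). Formulas: $\varphi ::= n \mid p \mid \bot \mid \varphi\to\varphi \mid @_{n}\varphi \mid \mathsf{F}\varphi \mid \Box\varphi$; $\neg\varphi:=\varphi\to\bot$; $\langle\mathsf{F}\rangle\varphi:=\neg\mathsf{F}\neg\varphi$. $@$-prefixed formulas have the form $@_n\varphi$. $\varphi[m/k]$ replaces every occurrence of nominal $k$ by $m$. Semantics. A model $\mathfrak{M}=(W,A,(R_a)_{a\in A},(\asymp_w)_{w\in W},V)$: $W,A$ nonempty, $R_a\subseteq W\times W$, $\asymp_w\subseteq A\times A$, $V:\mathsf{Prop}\cup\mathsf{Nom}\to\mathcal{P}(W\times A)$ with $V(n)=W\times\{\underline n\}$ for a unique $\underline n\in A$. Satisfaction: $(w,a)\models p$ iff $(w,a)\in V(p)$; $(w,a)\models n$ iff $\underline n=a$; $\bot$ never; $\to$ classical; $(w,a)\models@_n\varphi$ iff $(w,\underline n)\models\varphi$; $(w,a)\models\mathsf{F}\varphi$ iff $(w,b)\models\varphi$ for all $b$ with $a\asymp_wb$; $(w,a)\models\Box\varphi$ iff $(v,a)\models\varphi$ for all $v$ with $wR_av$. Tree sequents. Labels: natural numbers, and $\alpha\cdot_ni$ (an $n$-child of $\alpha$). A tree: set of labels containing exactly one natural number (root), closed under parents. Labelled formula: $\alpha:\psi$, $\psi$ $@$-prefixed. A (finite) tree sequent $\Gamma\stackrel{\mathcal{T}}{\Rightarrow}\Delta$ has finite $\Gamma,\Delta$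 and finite tree $\mathcal{T}$ containing their labels; a possibly infinite tree sequent allows countably infinite $\Gamma,\Delta,\mathcal{T}$. Calculus $\mathsf{T}\mathbf{EFL}^{ - }$ on finite tree sequents ($\alpha,\beta\in\mathcal{T}$; tree unchanged unless indicated). Initial: $\alpha:@_n\bot,\Gamma\Rightarrow\Delta$; $\alpha:@_n\varphi,\Gamma\Rightarrow\Delta,\alpha:@_n\varphi$. Rules (premises / conclusion): $(\mathsf{rep}_{=1})$ $\alpha:@_nm,\alpha:\varphi[n/k],\Gamma\Rightarrow\Delta$ / $\alpha:@_nm,\alpha:\varphi[m/k],\Gamma\Rightarrow\Delta$; $(\mathsf{rep}_{=2})$ $\alpha:@_nm,\alpha:\varphi[m/k],\Gamma\Rightarrow\Delta$ / $\alpha:@_nm,\alpha:\varphi[n/k],\Gamma\Rightarrow\Delta$; $(\mathsf{ref}_=)$ $\alpha:@_nn,\Gamma\Rightarrow\Delta$ / $\Gamma\Rightarrow\Delta$; $(\mathsf{rigid}_=)$ $\beta:@_nm,\Gamma\Rightarrow\Delta$ / $\alpha:@_nm,\Gamma\Rightarrow\Delta$; $(\to R)$ $\alpha:@_n\varphi,\Gamma\Rightarrow\Delta,\alpha:@_n\psi$ / $\Gamma\Rightarrow\Delta,\alpha:@_n(\varphi\to\psi)$; $(\to L)$ $\Gamma\Rightarrow\Delta,\alpha:@_n\varphi$ and $\alpha:@_n\psi,\Gamma\Rightarrow\Delta$ / $\alpha:@_n(\varphi\to\psi),\Gamma\Rightarrow\Delta$; $(@R)$ $\Gamma\Rightarrow\Delta,\alpha:@_m\varphi$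 / $\Gamma\Rightarrow\Delta,\alpha:@_n@_m\varphi$; $(@L)$ $\alpha:@_m\varphi,\Gamma\Rightarrow\Delta$ / $\alpha:@_n@_m\varphi,\Gamma\Rightarrow\Delta$; $(\mathsf{F}R)$ $\alpha:@_n\langle\mathsf{F}\rangle m,\Gamma\Rightarrow\Delta,\alpha:@_m\varphi$ / $\Gamma\Rightarrow\Delta,\alpha:@_n\mathsf{F}\varphi$, $m$ not in the conclusion; $(\mathsf{F}L)$ $\Gamma\Rightarrow\Delta,\alpha:@_n\langle\mathsf{F}\rangle m$ and $\alpha:@_m\varphi,\Gamma\Rightarrow\Delta$ / $\alpha:@_n\mathsf{F}\varphi,\Gamma\Rightarrow\Delta$; $(\Box R)$ $\Gamma\stackrel{\mathcal{T}\cup\{\alpha\cdot_ni\}}{\Rightarrow}\Delta,\alpha\cdot_ni:@_n\varphi$ / $\Gamma\stackrel{\mathcal{T}}{\Rightarrow}\Delta,\alpha:@_n\Box\varphi$, $i$ fresh in the conclusion; $(\Box L)$ $\beta:@_n\varphi,\Gamma\Rightarrow\Delta$ / $\alpha:@_n\Box\varphi,\Gamma\Rightarrow\Delta$, $\beta$ an $n$-child of $\alpha$; $(w\mathsf{lab})$ $\Gamma\stackrel{\mathcal{T}}{\Rightarrow}\Delta$ / $\Gamma\stackrel{\mathcal{T}\cup\{\alpha\}}{\Rightarrow}\Delta$ if $\mathcal{T}\cup\{\alpha\}$ is a tree. A possibly infinite tree sequent is provable in $\mathsf{T}\mathbf{EFL}^{ - }$ if some finite $\Gamma'\subseteq\Gamma$,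 $\Delta'\subseteq\Delta$, finite subtree $\mathcal{T}'\subseteq\mathcal{T}$ give a derivable $\Gamma'\stackrel{\mathcal{T}'}{\Rightarrow}\Delta'$. Saturation. $\Gamma\stackrel{\mathcal{T}}{\Rightarrow}\Delta$ is saturated if: (rep1) $\alpha:@_nm\in\Gamma$, $\alpha:\varphi[n/k]\in\Gamma$ imply $\alpha:\varphi[m/k]\in\Gamma$; (rep2) $\alpha:@_mn\in\Gamma$, $\alpha:\varphi[n/k]\in\Gamma$ imply $\alpha:\varphi[m/k]\in\Gamma$; (ref) $\alpha:@_nn\in\Gamma$ for all $\alpha\in\mathcal{T}$, all $n$; (rigid) $\alpha:@_nm\in\Gamma$ implies $\beta:@_nm\in\Gamma$ for all $\beta\in\mathcal{T}$; ($\to$r) $\alpha:@_n(\varphi\to\psi)\in\Delta$ implies $\alpha:@_n\varphi\in\Gamma$ and $\alpha:@_n\psi\in\Delta$; ($\to$l) $\alpha:@_n(\varphi\to\psi)\in\Gamma$ implies $\alpha:@_n\varphi\in\Delta$ or $\alpha:@_n\psi\in\Gamma$; ($@$r) $\alpha:@_n@_m\varphi\in\Delta$ implies $\alpha:@_m\varphi\in\Delta$; ($@$l) $\alpha:@_n@_m\varphi\in\Gamma$ implies $\alpha:@_m\varphi\in\Gamma$; ($\mathsf{F}$r) $\alpha:@_n\mathsf{F}\varphi\in\Delta$ implies for some $m$: $\alpha:@_n\langle\mathsf{F}\rangle m\in\Gamma$ and $\alpha:@_m\varphi\in\Delta$; ($\mathsf{F}$l) $\alpha:@_n\mathsf{F}\varphi\in\Gamma$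 implies for every $m$: $\alpha:@_n\langle\mathsf{F}\rangle m\in\Delta$ or $\alpha:@_m\varphi\in\Gamma$; ($\Box$r) $\alpha:@_n\Box\varphi\in\Delta$ implies $\beta:@_n\varphi\in\Delta$ for some $n$-child $\beta\in\mathcal{T}$ of $\alpha$; ($\Box$l) $\alpha:@_n\Box\varphi\in\Gamma$ implies $\beta:@_n\varphi\in\Gamma$ for all $n$-children $\beta\in\mathcal{T}$ of $\alpha$. -}

module Defs where

open import Data.Nat using (ℕ; _≡ᵇ_)
open import Data.Bool using (Bool; true; false; if_then_else_; _∨_)
open import Data.Product using (Σ; _×_; _,_; proj₁)
open import Data.Sum using (_⊎_)
open import Data.Empty using (⊥)
open import Data.List using (List; _∷_)
open import Data.List.Membership.Propositional using (_∈_)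
open import Data.List.Relation.Unary.All using (All)
open import Relation.Nullary using (¬_)
open import Relation.Binary.PropositionalEquality using (_≡_)
open import Relation.Binary.Structures using (IsEquivalence)
open import Function.Bundles using (_⇔_)

data Fm : Set where
  nom  : ℕ → Fm
  prop : ℕ → Fm
  ⊥'   : Fm
  _⇒_  : Fm → Fm → Fm
  at   : ℕ → Fm → Fm
  F    : Fm → Fm
  □    : Fm → Fm

infixr 5 _⇒_

neg : Fm → Fm
neg φ = φ ⇒ ⊥'

dF : Fm → Fm
dF φ = neg (F (neg φ))

subN : ℕ → ℕ → ℕ → ℕ
subN m k j = if j ≡ᵇ k then m else j

sub : ℕ → ℕ → Fm → Fm
sub m k (nom j)  = nom (subN m k j)
sub m k (prop p) = prop p
sub m k ⊥'       = ⊥'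
sub m k (φ ⇒ ψ)  = sub m k φ ⇒ sub m k ψ
sub m k (at j φ) = at (subN m k j) (sub m k φ)
sub m k (F φ)    = F (sub m k φ)
sub m k (□ φ)    = □ (sub m k φ)

occF : ℕ → Fm → Bool
occF m (nom j)  = m ≡ᵇ j
occF m (prop p) = false
occF m ⊥'       = false
occF m (φ ⇒ ψ)  = occF m φ ∨ occF m ψ
occF m (at j φ) = (m ≡ᵇ j) ∨ occF m φ
occF m (F φ)    = occF m φ
occF m (□ φ)    = occF m φ

data Label : Set where
  root  : ℕ → Label
  child : Label → ℕ → ℕ → Label     -- child α n i  =  α ·ₙ i

occL : ℕ → Label → Bool
occL m (root r)      = false
occL m (child α n i) = (m ≡ᵇ n) ∨ occL m α

IsTree : (Label → Set) → Set
IsTree T = Σ ℕ (λ r → T (root r))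
         × (∀ r r' → T (root r) → T (root r') → r ≡ r')
         × (∀ α n i → T (child α n i) → T α)

-- Labelled formula  α : @ₙ φ   is represented as  lf α n φ
data LF : Set where
  lf : Label → ℕ → Fm → LF

labelOf : LF → Label
labelOf (lf α n φ) = α

subLF : ℕ → ℕ → LF → LF
subLF m k (lf α j ψ) = lf α (subN m k j) (sub m k ψ)

occLF : ℕ → LF → Bool
occLF m (lf α j ψ) = occL m α ∨ (m ≡ᵇ j) ∨ occF m ψ

-- Finite tree sequents: finite sets represented by lists, considered up
-- to having the same elements (rule `ext`).

_≋_ : {A : Set} → List A → List A → Set
xs ≋ ys = ∀ x → (x ∈ xs) ⇔ (x ∈ ys)

WF : List LF → List Label → List LF → Set
WF Γ T Δ = IsTree (λ α → α ∈ T)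
         × All (λ p → labelOf p ∈ T) Γ
         × All (λ p → labelOf p ∈ T) Δ

Fresh : ℕ → List LF → List Label → List LF → Set
Fresh m Γ T Δ = All (λ p → occLF m p ≡ false) Γ
              × All (λ α → occL m α ≡ false) T
              × All (λ p → occLF m p ≡ false) Δ

-- Derivability in T EFL⁻.  Every sequent in a derivation is a tree
-- sequent (WF of each conclusion is required).
data Der : List LF → List Label → List LF → Set where
  ext   : ∀ {Γ T Δ Γ' T' Δ'} → Der Γ T Δ → Γ ≋ Γ' → T ≋ T' → Δ ≋ Δ' → Der Γ' T' Δ'
  ax⊥   : ∀ {Γ T Δ α n} → WF (lf α n ⊥' ∷ Γ) T Δ → Der (lf α n ⊥' ∷ Γ) T Δ
  ax    : ∀ {Γ T Δ α n φ} → WF (lf α n φ ∷ Γ) T (lf α n φ ∷ Δ)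
        → Der (lf α n φ ∷ Γ) T (lf α n φ ∷ Δ)
  rep₁  : ∀ {Γ T Δ α n m k j ψ}
        → Der (lf α n (nom m) ∷ subLF n k (lf α j ψ) ∷ Γ) T Δ
        → WF (lf α n (nom m) ∷ subLF m k (lf α j ψ) ∷ Γ) T Δ
        → Der (lf α n (nom m) ∷ subLF m k (lf α j ψ) ∷ Γ) T Δ
  rep₂  : ∀ {Γ T Δ α n m k j ψ}
        → Der (lf α n (nom m) ∷ subLF m k (lf α j ψ) ∷ Γ) T Δ
        → WF (lf α n (nom m) ∷ subLF n k (lf α j ψ) ∷ Γ) T Δ
        → Der (lf α n (nom m) ∷ subLF n k (lf α j ψ) ∷ Γ) T Δ
  ref=  : ∀ {Γ T Δ α n} → Der (lf α n (nom n) ∷ Γ) T Δ → WF Γ T Δ → Der Γ T Δ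
  rigid : ∀ {Γ T Δ α β n m} → Der (lf β n (nom m) ∷ Γ) T Δ
        → WF (lf α n (nom m) ∷ Γ) T Δ → Der (lf α n (nom m) ∷ Γ) T Δ
  ⇒R    : ∀ {Γ T Δ α n φ ψ} → Der (lf α n φ ∷ Γ) T (lf α n ψ ∷ Δ)
        → WF Γ T (lf α n (φ ⇒ ψ) ∷ Δ) → Der Γ T (lf α n (φ ⇒ ψ) ∷ Δ)
  ⇒L    : ∀ {Γ T Δ α n φ ψ} → Der Γ T (lf α n φ ∷ Δ) → Der (lf α n ψ ∷ Γ) T Δ
        → WF (lf α n (φ ⇒ ψ) ∷ Γ) T Δ → Der (lf α n (φ ⇒ ψ) ∷ Γ) T Δ
  atR   : ∀ {Γ T Δ α n m φ} → Der Γ T (lf α m φ ∷ Δ)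
        → WF Γ T (lf α n (at m φ) ∷ Δ) → Der Γ T (lf α n (at m φ) ∷ Δ)
  atL   : ∀ {Γ T Δ α n m φ} → Der (lf α m φ ∷ Γ) T Δ
        → WF (lf α n (at m φ) ∷ Γ) T Δ → Der (lf α n (at m φ) ∷ Γ) T Δ
  FR    : ∀ {Γ T Δ α n m φ} → Der (lf α n (dF (nom m)) ∷ Γ) T (lf α m φ ∷ Δ)
        → Fresh m Γ T (lf α n (F φ) ∷ Δ)
        → WF Γ T (lf α n (F φ) ∷ Δ) → Der Γ T (lf α n (F φ) ∷ Δ)
  FL    : ∀ {Γ T Δ α n m φ} → Der Γ T (lf α n (dF (nom m)) ∷ Δ)
        → Der (lf α m φ ∷ Γ) T Δ
        → WF (lf α n (F φ) ∷ Γ) T Δ → Der (lf α n (F φ) ∷ Γ) T Δ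
  □R    : ∀ {Γ T Δ α n i φ} → Der Γ (child α n i ∷ T) (lf (child α n i) n φ ∷ Δ)
        → ¬ (child α n i ∈ T)
        → WF Γ T (lf α n (□ φ) ∷ Δ) → Der Γ T (lf α n (□ φ) ∷ Δ)
  □L    : ∀ {Γ T Δ α n i φ} → Der (lf (child α n i) n φ ∷ Γ) T Δ
        → WF (lf α n (□ φ) ∷ Γ) T Δ → Der (lf α n (□ φ) ∷ Γ) T Δ
  wlab  : ∀ {Γ T Δ α} → Der Γ T Δ → WF Γ (α ∷ T) Δ → Der Γ (α ∷ T) Δ

-- Possibly infinite tree sequents: Γ, Δ : sets of labelled formulas,
-- T : set of labels (all countable since LF, Label are countable).

TreeSeq : (LF → Set) → (Label → Set) → (LF → Set) → Set
TreeSeq Γ T Δ = IsTree T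
              × (∀ p → Γ p → T (labelOf p))
              × (∀ p → Δ p → T (labelOf p))

Provable : (LF → Set) → (Label → Set) → (LF → Set) → Set
Provable Γ T Δ =
  Σ (List LF) λ Γ' → Σ (List Label) λ T' → Σ (List LF) λ Δ' →
    (∀ p → p ∈ Γ' → Γ p) × (∀ α → α ∈ T' → T α) × (∀ p → p ∈ Δ' → Δ p)
    × Der Γ' T' Δ'

Saturated : (LF → Set) → (Label → Set) → (LF → Set) → Set
Saturated Γ T Δ =
    (∀ α n m k j ψ → Γ (lf α n (nom m)) → Γ (subLF n k (lf α j ψ)) → Γ (subLF m k (lf α j ψ)))
  × (∀ α n m k j ψ → Γ (lf α m (nom n)) → Γ (subLF n k (lf α j ψ)) → Γ (subLF m k (lf α j ψ)))
  × (∀ α n → T α → Γ (lf α n (nom n)))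
  × (∀ α β n m → Γ (lf α n (nom m)) → T β → Γ (lf β n (nom m)))
  × (∀ α n φ ψ → Δ (lf α n (φ ⇒ ψ)) → Γ (lf α n φ) × Δ (lf α n ψ))
  × (∀ α n φ ψ → Γ (lf α n (φ ⇒ ψ)) → Δ (lf α n φ) ⊎ Γ (lf α n ψ))
  × (∀ α n m φ → Δ (lf α n (at m φ)) → Δ (lf α m φ))
  × (∀ α n m φ → Γ (lf α n (at m φ)) → Γ (lf α m φ))
  × (∀ α n φ → Δ (lf α n (F φ)) → Σ ℕ λ m → Γ (lf α n (dF (nom m))) × Δ (lf α m φ))
  × (∀ α n φ → Γ (lf α n (F φ)) → ∀ m → Δ (lf α n (dF (nom m))) ⊎ Γ (lf α m φ))
  × (∀ α n φ → Δ (lf α n (□ φ)) → Σ ℕ λ i → T (child α n i) × Δ (lf (child α n i) n φ))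
  × (∀ α n φ → Γ (lf α n (□ φ)) → ∀ i → T (child α n i) → Γ (lf (child α n i) n φ))

-- Models.  Agent domain A is given as a setoid (A, ≈); a model proper is
-- its quotient.  All relations must respect ≈.

record Structure : Set₁ where
  field
    W   : Set
    A   : Set
    _≈_ : A → A → Set
    R   : A → W → W → Set
    Cmp : W → A → A → Set
    VP  : ℕ → W → A → Set
    VN  : ℕ → W → A → Set

record IsModel (S : Structure) : Set where
  open Structure S
  field
    W-ne    : W
    A-ne    : A
    ≈-equiv : IsEquivalence _≈_
    R-resp  : ∀ a b w v → a ≈ b → R a w v → R b w v
    Cmp-resp : ∀ w a a' b b' → a ≈ a' → b ≈ b' → Cmp w a b → Cmp w a' b'
    VP-resp : ∀ p w a b → a ≈ b → VP p w a → VP p w b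
    VN-resp : ∀ n w a b → a ≈ b → VN n w a → VN n w b
    nomv    : ∀ n → Σ A λ c → ∀ w a → VN n w a ⇔ (c ≈ a)

module _ {S : Structure} (M : IsModel S) where
  open Structure S
  open IsModel M

  den : ℕ → A
  den n = proj₁ (nomv n)

  Sat : W → A → Fm → Set
  Sat w a (nom n)  = den n ≈ a
  Sat w a (prop p) = VP p w a
  Sat w a ⊥'       = ⊥
  Sat w a (φ ⇒ ψ)  = Sat w a φ → Sat w a ψ
  Sat w a (at n φ) = Sat w (den n) φ
  Sat w a (F φ)    = ∀ b → Cmp w a b → Sat w b φ
  Sat w a (□ φ)    = ∀ v → R a w v → Sat v a φ

-- The canonical model built from Γ ⇒[T] Δ.  Agents are nominals, with
-- n ≈ m iff n ∼ m, so the class |n| is represented by n.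

Sim : (LF → Set) → (Label → Set) → ℕ → ℕ → Set
Sim Γ T n m = Σ Label λ α → T α × Γ (lf α n (nom m))

Canon : (LF → Set) → (Label → Set) → Structure
Canon Γ T = record
  { W   = Σ Label T
  ; A   = ℕ
  ; _≈_ = Sim Γ T
  ; R   = λ n w v → Σ ℕ λ m → Sim Γ T n m × Σ ℕ λ i → proj₁ v ≡ child (proj₁ w) m i
  ; Cmp = λ w n m → Γ (lf (proj₁ w) n (dF (nom m)))
  ; VP  = λ p w n → Γ (lf (proj₁ w) n (prop p))
  ; VN  = λ m w n → Γ (lf (proj₁ w) n (nom m))
  }

-- Saturation under replacement and rigidity makes these equalities an
-- equivalence which every component of the model respects, and unprovability
-- only enters through the two initial sequents: no formula lies in both Γ and
-- Δ, and no @ₙ⊥ lies in Γ.  The truth lemma is then a simultaneous induction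
-- on formulas, each saturation clause supplying the corresponding case.
module Submission where

open import Defs
open import Data.Product using (Σ; _×_; _,_; proj₁; proj₂)
open import Relation.Nullary using (¬_)
open import Relation.Binary.Structures using (IsEquivalence)
open import Data.Nat using (ℕ; zero; suc; _≡ᵇ_; _<_; s≤s; _⊔_)
open import Data.Bool using (true; false)
open import Data.Nat.Properties using (m≤m⊔n; m≤n⊔m; ≤-<-trans; ≤-refl; n<1+n)
open import Data.Sum using (_⊎_; inj₁; inj₂)
open import Data.Empty using (⊥-elim)
open import Data.List using (List; []; _∷_)
open import Data.List.Relation.Unary.Any using (here; there)
open import Data.List.Relation.Unary.All using ([]; _∷_; lookup)
open import Data.List.Membership.Propositional using (_∈_)
open import Relation.Binary.PropositionalEquality using (_≡_; refl; sym; trans; cong; cong₂; subst)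
open import Function.Bundles using (mk⇔)

≡ᵇ-refl : ∀ k → (k ≡ᵇ k) ≡ true
≡ᵇ-refl zero    = refl
≡ᵇ-refl (suc k) = ≡ᵇ-refl k

<⇒≡ᵇ-false : ∀ {j k} → j < k → (j ≡ᵇ k) ≡ false
<⇒≡ᵇ-false {zero}  {suc k} _         = refl
<⇒≡ᵇ-false {suc j} {suc k} (s≤s j<k) = <⇒≡ᵇ-false j<k

subN-hit : ∀ m k → subN m k k ≡ m
subN-hit m k rewrite ≡ᵇ-refl k = refl

subN-miss : ∀ m {k j} → j < k → subN m k j ≡ j
subN-miss m j<k rewrite <⇒≡ᵇ-false j<k = refl

maxNom : Fm → ℕ
maxNom (nom j)  = j
maxNom (prop p) = 0
maxNom ⊥'       = 0
maxNom (φ ⇒ ψ)  = maxNom φ ⊔ maxNom ψ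
maxNom (at j φ) = j ⊔ maxNom φ
maxNom (F φ)    = maxNom φ
maxNom (□ φ)    = maxNom φ

sub-fresh : ∀ m {k} φ → maxNom φ < k → sub m k φ ≡ φ
sub-fresh m (nom j)  j<k = cong nom (subN-miss m j<k)
sub-fresh m (prop p) _   = refl
sub-fresh m ⊥'       _   = refl
sub-fresh m (φ ⇒ ψ)  φψ<k = cong₂ _⇒_
  (sub-fresh m φ (≤-<-trans (m≤m⊔n (maxNom φ) (maxNom ψ)) φψ<k))
  (sub-fresh m ψ (≤-<-trans (m≤n⊔m (maxNom φ) (maxNom ψ)) φψ<k))
sub-fresh m (at j φ) jφ<k = cong₂ at
  (subN-miss m (≤-<-trans (m≤m⊔n j (maxNom φ)) jφ<k))
  (sub-fresh m φ (≤-<-trans (m≤n⊔m j (maxNom φ)) jφ<k))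
sub-fresh m (F φ)    φ<k = cong F (sub-fresh m φ φ<k)
sub-fresh m (□ φ)    φ<k = cong □ (sub-fresh m φ φ<k)

-- With k fresh, the instances [n/k] and [m/k] of  α : @ₖ ψ  are  α : @ₙ ψ  and
-- α : @ₘ ψ, so the replacement clause can move a whole formula between agents.
subLF-fresh-agent : ∀ α m ψ → subLF m (suc (maxNom ψ)) (lf α (suc (maxNom ψ)) ψ) ≡ lf α m ψ
subLF-fresh-agent α m ψ = cong₂ (lf α) (subN-hit m (suc (maxNom ψ))) (sub-fresh m ψ ≤-refl)

subLF-fresh-⟨F⟩ : ∀ α a m → subLF m (suc a) (lf α a (dF (nom (suc a)))) ≡ lf α a (dF (nom m))
subLF-fresh-⟨F⟩ α a m = cong₂ (λ b c → lf α b (dF (nom c))) (subN-miss m (n<1+n a)) (subN-hit m (suc a))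

ancestors : Label → List Label
ancestors (root r)      = root r ∷ []
ancestors (child α n i) = child α n i ∷ ancestors α

rootOf : Label → ℕ
rootOf (root r)      = r
rootOf (child α n i) = rootOf α

∈-ancestors : ∀ α → α ∈ ancestors α
∈-ancestors (root r)      = here refl
∈-ancestors (child α n i) = here refl

rootOf-∈-ancestors : ∀ α → root (rootOf α) ∈ ancestors α
rootOf-∈-ancestors (root r)      = here refl
rootOf-∈-ancestors (child α n i) = there (rootOf-∈-ancestors α)

root-∈-ancestors : ∀ {α r} → root r ∈ ancestors α → r ≡ rootOf α
root-∈-ancestors {root _}      (here refl) = refl
root-∈-ancestors {child α n i} (there r∈)  = root-∈-ancestors {α} r∈

ancestors-parent-closed : ∀ α {β n i} → child β n i ∈ ancestors α → β ∈ ancestors α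
ancestors-parent-closed (root r)      (here ())
ancestors-parent-closed (root r)      (there ())
ancestors-parent-closed (child α m j) (here refl) = there (∈-ancestors α)
ancestors-parent-closed (child α m j) (there c∈)  = there (ancestors-parent-closed α c∈)

ancestors-isTree : ∀ α → IsTree (_∈ ancestors α)
ancestors-isTree α = (rootOf α , rootOf-∈-ancestors α)
                   , (λ r r' r∈ r'∈ → trans (root-∈-ancestors r∈) (sym (root-∈-ancestors r'∈)))
                   , (λ β n i → ancestors-parent-closed α)

ancestors-⊆ : ∀ {T : Label → Set} → IsTree T → ∀ {α} → T α → ∀ β → β ∈ ancestors α → T β
ancestors-⊆ tree {root r}      αT _ (here refl) = αT
ancestors-⊆ tree {child α n i} αT _ (here refl) = αT
ancestors-⊆ tree {child α n i} αT β (there β∈)  = ancestors-⊆ tree (proj₂ (proj₂ tree) α n i αT) β β∈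

module _ {Γ : LF → Set} {T : Label → Set} {Δ : LF → Set}
         (ts : TreeSeq Γ T Δ) (unprovable : ¬ Provable Γ T Δ) where

  unprovable⇒disjoint : ∀ {α n φ} → Γ (lf α n φ) → ¬ Δ (lf α n φ)
  unprovable⇒disjoint {α} g d = unprovable
    ( _ ∷ [] , ancestors α , _ ∷ []
    , (λ _ → lookup {P = Γ} (g ∷ []))
    , ancestors-⊆ (proj₁ ts) (proj₁ (proj₂ ts) _ g)
    , (λ _ → lookup {P = Δ} (d ∷ []))
    , ax (ancestors-isTree α , ∈-ancestors α ∷ [] , ∈-ancestors α ∷ []))

  unprovable⇒⊥∉Γ : ∀ {α n} → ¬ Γ (lf α n ⊥')
  unprovable⇒⊥∉Γ {α} g = unprovable
    ( _ ∷ [] , ancestors α , []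
    , (λ _ → lookup {P = Γ} (g ∷ []))
    , ancestors-⊆ (proj₁ ts) (proj₁ (proj₂ ts) _ g)
    , (λ _ ())
    , ax⊥ (ancestors-isTree α , ∈-ancestors α ∷ [] , []))

module Canonical (Γ : LF → Set) (T : Label → Set) (Δ : LF → Set) (w₀ : Σ Label T)
  (disjoint : ∀ {α n φ} → Γ (lf α n φ) → ¬ Δ (lf α n φ))
  (⊥∉Γ : ∀ {α n} → ¬ Γ (lf α n ⊥'))
  (sat-rep : ∀ α n m k j ψ → Γ (lf α n (nom m)) → Γ (subLF n k (lf α j ψ)) → Γ (subLF m k (lf α j ψ)))
  (sat-ref : ∀ α n → T α → Γ (lf α n (nom n)))
  (sat-rigid : ∀ α β n m → Γ (lf α n (nom m)) → T β → Γ (lf β n (nom m)))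
  (sat-⇒r : ∀ α n φ ψ → Δ (lf α n (φ ⇒ ψ)) → Γ (lf α n φ) × Δ (lf α n ψ))
  (sat-⇒l : ∀ α n φ ψ → Γ (lf α n (φ ⇒ ψ)) → Δ (lf α n φ) ⊎ Γ (lf α n ψ))
  (sat-atr : ∀ α n m φ → Δ (lf α n (at m φ)) → Δ (lf α m φ))
  (sat-atl : ∀ α n m φ → Γ (lf α n (at m φ)) → Γ (lf α m φ))
  (sat-Fr : ∀ α n φ → Δ (lf α n (F φ)) → Σ ℕ λ m → Γ (lf α n (dF (nom m))) × Δ (lf α m φ))
  (sat-Fl : ∀ α n φ → Γ (lf α n (F φ)) → ∀ m → Δ (lf α n (dF (nom m))) ⊎ Γ (lf α m φ))
  (sat-□r : ∀ α n φ → Δ (lf α n (□ φ)) → Σ ℕ λ i → T (child α n i) × Δ (lf (child α n i) n φ))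
  (sat-□l : ∀ α n φ → Γ (lf α n (□ φ)) → ∀ i → T (child α n i) → Γ (lf (child α n i) n φ))
  where

  replace : ∀ {α a b} ψ → Γ (lf α a (nom b)) → Γ (lf α a ψ) → Γ (lf α b ψ)
  replace {α} {a} {b} ψ a=b g = subst Γ (subLF-fresh-agent α b ψ)
    (sat-rep α a b k k ψ a=b (subst Γ (sym (subLF-fresh-agent α a ψ)) g))
    where k = suc (maxNom ψ)

  at-sym : ∀ {α a b} → T α → Γ (lf α a (nom b)) → Γ (lf α b (nom a))
  at-sym {a = a} αT a=b = replace (nom a) a=b (sat-ref _ a αT)

  _∼_ : ℕ → ℕ → Set
  _∼_ = Sim Γ T

  ∼⇒at : ∀ {α a b} → T α → a ∼ b → Γ (lf α a (nom b))
  ∼⇒at αT (β , _ , a=b) = sat-rigid β _ _ _ a=b αT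

  replace-∼ : ∀ {α a b} ψ → T α → a ∼ b → Γ (lf α a ψ) → Γ (lf α b ψ)
  replace-∼ ψ αT a∼b = replace ψ (∼⇒at αT a∼b)

  ∼-refl : ∀ {a} → a ∼ a
  ∼-refl {a} = proj₁ w₀ , proj₂ w₀ , sat-ref (proj₁ w₀) a (proj₂ w₀)

  ∼-sym : ∀ {a b} → a ∼ b → b ∼ a
  ∼-sym (β , βT , a=b) = β , βT , at-sym βT a=b

  ∼-trans : ∀ {a b c} → a ∼ b → b ∼ c → a ∼ c
  ∼-trans {c = c} a∼b (β , βT , b=c) = β , βT , replace-∼ (nom c) βT (∼-sym a∼b) b=c

  ∼-isEquivalence : IsEquivalence _∼_
  ∼-isEquivalence = record { refl = ∼-refl ; sym = ∼-sym ; trans = ∼-trans }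

  ⟨F⟩-resp-∼ : ∀ (w : Σ Label T) a a' b b' → a ∼ a' → b ∼ b'
             → Γ (lf (proj₁ w) a (dF (nom b))) → Γ (lf (proj₁ w) a' (dF (nom b')))
  ⟨F⟩-resp-∼ (α , αT) a a' b b' a∼a' b∼b' g =
    subst Γ (subLF-fresh-⟨F⟩ α a' b')
      (sat-rep α b b' (suc a') a' (dF (nom (suc a'))) (∼⇒at αT b∼b')
        (subst Γ (sym (subLF-fresh-⟨F⟩ α a' b)) (replace-∼ (dF (nom b)) αT a∼a' g)))

  canonical-isModel : IsModel (Canon Γ T)
  canonical-isModel = record
    { W-ne     = w₀
    ; A-ne     = 0
    ; ≈-equiv  = ∼-isEquivalence
    ; R-resp   = λ { a b w v a∼b (m , a∼m , i , v≡) → m , ∼-trans (∼-sym a∼b) a∼m , i , v≡ }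
    ; Cmp-resp = ⟨F⟩-resp-∼
    ; VP-resp  = λ p (α , αT) a b → replace-∼ (prop p) αT
    ; VN-resp  = λ n (α , αT) a b → replace-∼ (nom n) αT
    ; nomv     = λ m → m , λ (α , αT) a →
        mk⇔ (λ a=m → α , αT , at-sym αT a=m) (λ m∼a → at-sym αT (∼⇒at αT m∼a))
    }

  private
    M : IsModel (Canon Γ T)
    M = canonical-isModel

  truth-Γ : ∀ φ α (αT : T α) n → Γ (lf α n φ) → Sat M (α , αT) n φ
  truth-Δ : ∀ φ α (αT : T α) n → Δ (lf α n φ) → ¬ Sat M (α , αT) n φ

  truth-Γ (nom m)  α αT n g = α , αT , at-sym αT g
  truth-Γ (prop p) α αT n g = g
  truth-Γ ⊥'       α αT n g = ⊥∉Γ g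
  truth-Γ (φ ⇒ ψ)  α αT n g φ-true with sat-⇒l α n φ ψ g
  ... | inj₁ d = ⊥-elim (truth-Δ φ α αT n d φ-true)
  ... | inj₂ g' = truth-Γ ψ α αT n g'
  truth-Γ (at m φ) α αT n g = truth-Γ φ α αT m (sat-atl α n m φ g)
  truth-Γ (F φ)    α αT n g b n⟨F⟩b with sat-Fl α n φ g b
  ... | inj₁ d = ⊥-elim (disjoint n⟨F⟩b d)
  ... | inj₂ g' = truth-Γ φ α αT b g'
  truth-Γ (□ φ)    α αT n g (β , βT) (m , n∼m , i , refl) =
    truth-Γ φ β βT n (replace-∼ φ βT (∼-sym n∼m) m-child)
    where
    m-child : Γ (lf β m φ)
    m-child = sat-□l α m φ (replace-∼ (□ φ) αT n∼m g) i βT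

  truth-Δ (nom m)  α αT n d m∼n = disjoint (at-sym αT (∼⇒at αT m∼n)) d
  truth-Δ (prop p) α αT n d g = disjoint g d
  truth-Δ ⊥'       α αT n d ()
  truth-Δ (φ ⇒ ψ)  α αT n d f with sat-⇒r α n φ ψ d
  ... | g , d' = truth-Δ ψ α αT n d' (f (truth-Γ φ α αT n g))
  truth-Δ (at m φ) α αT n d = truth-Δ φ α αT m (sat-atr α n m φ d)
  truth-Δ (F φ)    α αT n d f with sat-Fr α n φ d
  ... | m , n⟨F⟩m , d' = truth-Δ φ α αT m d' (f m n⟨F⟩m)
  truth-Δ (□ φ)    α αT n d f with sat-□r α n φ d
  ... | i , βT , d' = truth-Δ φ (child α n i) βT n d' (f (child α n i , βT) (n , ∼-refl , i , refl))

lemma2 : (Γ : LF → Set) (T : Label → Set) (Δ : LF → Set)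
       → TreeSeq Γ T Δ → Saturated Γ T Δ → ¬ Provable Γ T Δ
       → IsEquivalence (Sim Γ T)
         × Σ (IsModel (Canon Γ T)) λ M →
             ∀ α (αT : T α) n φ →
               (Γ (lf α n φ) → Sat M (α , αT) n φ)
               × (Δ (lf α n φ) → ¬ Sat M (α , αT) n φ)
lemma2 Γ T Δ ts@(((r₀ , r₀∈T) , _) , _)
       (sat-rep , _ , sat-ref , sat-rigid , sat-⇒r , sat-⇒l , sat-atr , sat-atl , sat-Fr , sat-Fl , sat-□r , sat-□l)
       unprovable =
  ∼-isEquivalence , canonical-isModel , λ α αT n φ → truth-Γ φ α αT n , truth-Δ φ α αT n
  where
  open Canonical Γ T Δ (root r₀ , r₀∈T) (unprovable⇒disjoint ts unprovable) (unprovable⇒⊥∉Γ ts unprovable)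
                 sat-rep sat-ref sat-rigid sat-⇒r sat-⇒l sat-atr sat-atl sat-Fr sat-Fl sat-□r sat-□l
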